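{- Let $n\ge1$, $\mathcal{M}=\{1^{k_1},\ldots,n^{k_n}\}$ with all $k_i\ge1$, $K=k_1+\cdots+k_n$, and $m\ge1$. Then $$|\mathcal{P}_{\mathcal{M},m}|=\frac{m^n}{K-n+1}\binom{K-n+m}{m}.$$
   Context: Let $I=\{i: k_i>1\}$ and for $i\in I$ let $\mathcal{M}_i=\{i_1,i_2,\ldots,i_{k_i-1}\}$ be a set of $k_i-1$ distinct formal symbols; let $X=\{0\}\cup\bigcup_{i\in I}\mathcal{M}_i$ (a set of $K-n+1$ distinct elements). $\mathcal{P}_{\mathcal{M},m}$ is the set of pairs $(P,S)$ where $P$ is a multiset of size $m$ with elements from $X$, and $S=(a_1,b_1)(a_2,b_2)\cdots(a_n,b_n)$ is a sequence of $n$ pairs such that each $a_j$ is an element occurring in $P$, each $b_j$ is a positive integer not exceeding the number of occurrences of $a_j$ in $P$, and $a_n=0$. -}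

module Defs where

open import Data.Nat using (ℕ; zero; suc; _+_; _∸_; _≤_)
open import Data.Fin using (Fin; zero; suc)
open import Data.Vec using (Vec; []; _∷_; lookup)
import Data.Vec as V
open import Data.Maybe using (Maybe; nothing; just)
open import Data.Product using (Σ; _×_; _,_; proj₁)
open import Data.Unit using (⊤; tt)
open import Relation.Binary.PropositionalEquality using (_≡_)

-- The multiset 𝓜 = {1^{k₁},…,n^{kₙ}} is given by k : Vec ℕ n.
-- The ground set X = {0} ∪ ⋃_{i∈I} 𝓜_i, where 𝓜_i = {i_1,…,i_{k_i-1}}.
-- `nothing` is the element 0; `just (i , j)` is the symbol i_{j+1}.
-- (For k_i = 1, Fin 0 is empty, so only i ∈ I contribute.)
X : ∀ {n} → Vec ℕ n → Set
X {n} k = Maybe (Σ (Fin n) λ i → Fin (lookup k i ∸ 1))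

-- A multiset over X, given by its multiplicity table:
-- multiplicity of 0, and for each i a vector of multiplicities of i_1..i_{k_i-1}.
MultRest : ∀ {n} → Vec ℕ n → Set
MultRest [] = ⊤
MultRest (ki ∷ k) = Vec ℕ (ki ∸ 1) × MultRest k

Multiset : ∀ {n} → Vec ℕ n → Set
Multiset k = ℕ × MultRest k

multRest : ∀ {n} (k : Vec ℕ n) → MultRest k → (i : Fin n) → Fin (lookup k i ∸ 1) → ℕ
multRest (ki ∷ k) (v , r) zero j = lookup v j
multRest (ki ∷ k) (v , r) (suc i) j = multRest k r i j

mult : ∀ {n} {k : Vec ℕ n} → Multiset k → X k → ℕ
mult (c , r) nothing = c
mult {k = k} (c , r) (just (i , j)) = multRest k r i j

sizeRest : ∀ {n} (k : Vec ℕ n) → MultRest k → ℕ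
sizeRest [] tt = 0
sizeRest (ki ∷ k) (v , r) = V.sum v + sizeRest k r

size : ∀ {n} {k : Vec ℕ n} → Multiset k → ℕ
size {k = k} (c , r) = c + sizeRest k r

Pair : ∀ {n} {k : Vec ℕ n} → Multiset k → Set
Pair {k = k} P = Σ (X k) λ a → Σ ℕ λ b → (1 ≤ b) × (b ≤ mult P a)

LastZero : ∀ {n} {k : Vec ℕ n} {P : Multiset k} {l : ℕ} → Vec (Pair P) l → Set
LastZero [] = ⊤
LastZero (x ∷ []) = proj₁ x ≡ nothing
LastZero (x ∷ y ∷ r) = LastZero (y ∷ r)

PMm : ∀ {n} → Vec ℕ n → ℕ → Set
PMm {n} k m =
  Σ (Multiset k) λ P → (size P ≡ m) × (Σ (Vec (Pair P) n) λ S → LastZero S)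

-- A pair (a, b) with 1 ≤ b ≤ mult P a picks one of the m elements of P counted with multiplicity,
-- so the first n − 1 pairs of S contribute m^(n−1) choices, and the last pair marks one of the c
-- occurrences of 0 in P. Writing the multiplicities of P as (c, v) with v ∈ ℕ^(K−n) and c + Σv = m,
-- the mark b ∈ [1, c] cuts c into b − 1 and c − b: these are the compositions of m − 1 into
-- K − n + 2 parts, C(K − n + m, m − 1) of them. The absorption identity
-- m · C(K − n + m, m) = (K − n + 1) · C(K − n + m, m − 1) turns the product into the stated quotient.
module Submission where

open import Defs
open import Data.Nat using (ℕ; zero; suc; _+_; _*_; _∸_; _^_; _≤_; _/_; z≤n; s≤s)
open import Data.Nat.Properties
  using (≡-irrelevant; ≤-irrelevant; suc-injective; +-identityʳ; *-identityʳ; *-identityˡ; +-comm; +-suc; +-assoc;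
         m+n≡0⇒m≡0; m+n≡0⇒n≡0; m+[n∸m]≡n; m+n∸m≡n; m+n∸n≡m; m∸n+n≡m; m≤m+n)
open import Data.Nat.Combinatorics using (_C_; nCn≡1; nC1≡n; nCk+nC[k+1]≡[n+1]C[k+1])
open import Data.Nat.DivMod using (m*n/n≡m)
open import Data.Nat.Tactic.RingSolver using (solve-∀)
open import Data.Fin using (Fin; zero; suc; toℕ; fromℕ<)
open import Data.Fin.Properties using (+↔⊎; *↔×; toℕ<n; toℕ-fromℕ<; fromℕ<-toℕ)
open import Data.Vec using (Vec; []; _∷_; _++_; lookup; sum; splitAt; map)
open import Data.Vec.Properties using (++-injective; sum-++)
open import Data.Maybe using (Maybe; nothing; just)
open import Data.Product using (Σ; _×_; _,_; proj₁; proj₂)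
open import Data.Sum using (_⊎_; inj₁; inj₂)
open import Data.Unit using (tt)
open import Data.Product.Function.NonDependent.Propositional using (_×-↔_)
open import Data.Sum.Function.Propositional using (_⊎-↔_)
open import Data.Product.Function.Dependent.Propositional using (Σ-↔)
open import Function.Bundles using (_↔_; mk↔ₛ′; Inverse)
open import Function.Properties.Inverse using (↔-refl; ↔-sym; ↔-trans)
open import Function.Related.TypeIsomorphisms using (Σ-assoc)
open import Relation.Binary.PropositionalEquality

pascal : ∀ a b → (suc a + suc b) C suc b ≡ (a + suc b) C suc b + (suc a + b) C b
pascal a b = begin
  suc (a + suc b) C suc b                 ≡⟨ nCk+nC[k+1]≡[n+1]C[k+1] (a + suc b) b ⟨
  (a + suc b) C b + (a + suc b) C suc b   ≡⟨ +-comm ((a + suc b) C b) _ ⟩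
  (a + suc b) C suc b + (a + suc b) C b   ≡⟨ cong (λ n → (a + suc b) C suc b + n C b) (+-suc a b) ⟩
  (a + suc b) C suc b + (suc a + b) C b   ∎
  where open ≡-Reasoning

-- (k + 1) · C(n, k + 1) = (n − k) · C(n, k) for n = a + b + 1 and k = b, from Pascal's rule alone.
absorption : ∀ a b → suc b * ((a + suc b) C suc b) ≡ suc a * ((suc a + b) C b)
absorption a zero = begin
  (a + 1) C 1 + 0   ≡⟨ +-identityʳ _ ⟩
  (a + 1) C 1       ≡⟨ nC1≡n (a + 1) ⟩
  a + 1             ≡⟨ +-comm a 1 ⟩
  suc a             ≡⟨ *-identityʳ (suc a) ⟨
  suc a * 1         ∎
  where open ≡-Reasoning
absorption zero (suc b) = begin
  suc (suc b) * (suc (suc b) C suc (suc b))   ≡⟨ cong (suc (suc b) *_) (nCn≡1 (suc (suc b))) ⟩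
  suc (suc b) * 1                             ≡⟨ *-identityʳ (suc (suc b)) ⟩
  1 + suc b                                   ≡⟨ cong₂ _+_ (nCn≡1 (suc b)) (*-identityʳ (suc b)) ⟨
  suc b C suc b + suc b * 1                   ≡⟨ cong (λ x → suc b C suc b + suc b * x) (nCn≡1 (suc b)) ⟨
  suc b C suc b + suc b * (suc b C suc b)     ≡⟨ cong (suc b C suc b +_) (absorption zero b) ⟩
  suc b C suc b + (1 * (suc b C b))           ≡⟨ cong (suc b C suc b +_) (*-identityˡ _) ⟩
  suc b C suc b + suc b C b                   ≡⟨ pascal zero b ⟨
  suc (suc b) C suc b                         ≡⟨ *-identityˡ _ ⟨
  1 * (suc (suc b) C suc b)                   ∎
  where open ≡-Reasoning
absorption (suc a) (suc b) = begin
  suc (suc b) * ((suc a + suc (suc b)) C suc (suc b))  ≡⟨ cong (suc (suc b) *_) (pascal a (suc b)) ⟩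
  suc (suc b) * (x + y)                                ≡⟨ rearrange (suc b) x y ⟩
  suc (suc b) * x + (y + suc b * y)                    ≡⟨ cong₂ (λ u v → u + (y + v)) (absorption a (suc b)) (absorption (suc a) b) ⟩
  suc a * y + (y + suc (suc a) * z)                    ≡⟨ rearrange′ (suc a) y z ⟩
  suc (suc a) * (y + z)                                ≡⟨ cong (suc (suc a) *_) (pascal (suc a) b) ⟨
  suc (suc a) * ((suc (suc a) + suc b) C suc b)        ∎
  where
  open ≡-Reasoning
  x = (a + suc (suc b)) C suc (suc b)
  y = (suc a + suc b) C suc b
  z = (suc (suc a) + b) C b
  rearrange : ∀ b x y → suc b * (x + y) ≡ suc b * x + (y + b * y)
  rearrange = solve-∀
  rearrange′ : ∀ a y z → a * y + (y + suc a * z) ≡ suc a * (y + z)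
  rearrange′ = solve-∀

scaled-absorption : ∀ p d b → (suc b * p * ((d + suc b) C suc b)) / suc d ≡ p * ((suc d + b) C b)
scaled-absorption p d b = begin
  (suc b * p * x) / suc d       ≡⟨ cong (_/ suc d) (rearrange (suc b) p x) ⟩
  (p * (suc b * x)) / suc d     ≡⟨ cong (λ z → (p * z) / suc d) (absorption d b) ⟩
  (p * (suc d * y)) / suc d     ≡⟨ cong (_/ suc d) (rearrange′ p (suc d) y) ⟩
  (p * y * suc d) / suc d       ≡⟨ m*n/n≡m (p * y) (suc d) ⟩
  p * y                         ∎
  where
  open ≡-Reasoning
  x = (d + suc b) C suc b
  y = (suc d + b) C b
  rearrange : ∀ b p x → b * p * x ≡ p * (b * x)
  rearrange = solve-∀
  rearrange′ : ∀ p d y → p * (d * y) ≡ p * y * d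
  rearrange′ = solve-∀

infixr 1 _⟫_
_⟫_ : ∀ {A B C : Set} → A ↔ B → B ↔ C → A ↔ C
_⟫_ = ↔-trans

subst-↔ : ∀ {A : Set} (F : A → Set) {x y : A} → x ≡ y → F x ↔ F y
subst-↔ F refl = ↔-refl

≡×-subst : ∀ {x m} (U : ℕ → Set) → ((x ≡ m) × U x) ↔ ((x ≡ m) × U m)
≡×-subst U = mk↔ₛ′ (λ { (refl , u) → refl , u }) (λ { (refl , u) → refl , u })
  (λ { (refl , u) → refl }) (λ { (refl , u) → refl })

Σ-×-factor : ∀ {A F : Set} {B C : A → Set} → Σ A (λ a → B a × (F × C a)) ↔ (F × Σ A (λ a → B a × C a))
Σ-×-factor = mk↔ₛ′ (λ (a , b , f , c) → f , a , b , c) (λ (f , a , b , c) → a , b , f , c) (λ _ → refl) (λ _ → refl)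

Fin-+↔⊎ : ∀ {m n} → (Fin m ⊎ Fin n) ↔ Fin (m + n)
Fin-+↔⊎ = ↔-sym +↔⊎

Σ-Fin-suc : ∀ {n} {F : Fin (suc n) → Set} → Σ (Fin (suc n)) F ↔ (F zero ⊎ Σ (Fin n) (λ i → F (suc i)))
Σ-Fin-suc = mk↔ₛ′ (λ { (zero , x) → inj₁ x ; (suc i , x) → inj₂ (i , x) })
                  (λ { (inj₁ x) → zero , x ; (inj₂ (i , x)) → suc i , x })
                  (λ { (inj₁ x) → refl ; (inj₂ (i , x)) → refl })
                  (λ { (zero , x) → refl ; (suc i , x) → refl })

Σ-Maybe : ∀ {A : Set} {F : Maybe A → Set} → Σ (Maybe A) F ↔ (F nothing ⊎ Σ A (λ a → F (just a)))
Σ-Maybe = mk↔ₛ′ (λ { (nothing , x) → inj₁ x ; (just a , x) → inj₂ (a , x) })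
                (λ { (inj₁ x) → nothing , x ; (inj₂ (a , x)) → just a , x })
                (λ { (inj₁ x) → refl ; (inj₂ (a , x)) → refl })
                (λ { (nothing , x) → refl ; (just a , x) → refl })

Σ-lookup↔Fin-sum : ∀ {d} (v : Vec ℕ d) → Σ (Fin d) (λ i → Fin (lookup v i)) ↔ Fin (sum v)
Σ-lookup↔Fin-sum [] = mk↔ₛ′ (λ { (() , _) }) (λ ()) (λ ()) (λ { (() , _) })
Σ-lookup↔Fin-sum (x ∷ v) = Σ-Fin-suc ⟫ (↔-refl ⊎-↔ Σ-lookup↔Fin-sum v) ⟫ Fin-+↔⊎

Vec-suc↔× : ∀ {A : Set} {n} → Vec A (suc n) ↔ (A × Vec A n)
Vec-suc↔× = mk↔ₛ′ (λ { (x ∷ v) → x , v }) (λ (x , v) → x ∷ v) (λ _ → refl) (λ { (x ∷ v) → refl })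

Vec↔Fin^ : ∀ {A : Set} {s} n → A ↔ Fin s → Vec A n ↔ Fin (s ^ n)
Vec↔Fin^ zero A↔Fin = mk↔ₛ′ (λ _ → zero) (λ _ → []) (λ { zero → refl }) (λ { [] → refl })
Vec↔Fin^ (suc n) A↔Fin = Vec-suc↔× ⟫ (A↔Fin ×-↔ Vec↔Fin^ n A↔Fin) ⟫ ↔-sym *↔×

++↔ : ∀ {A : Set} {m n} → (Vec A m × Vec A n) ↔ Vec A (m + n)
++↔ {m = m} = mk↔ₛ′ (λ (v , w) → v ++ w) split (λ u → sym (proj₂ (proj₂ (splitAt m u)))) split-++
  where
  split = λ u → proj₁ (splitAt m u) , proj₁ (proj₂ (splitAt m u))
  split-++ : ∀ vw → split (proj₁ vw ++ proj₂ vw) ≡ vw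
  split-++ (v , w) with splitAt m (v ++ w)
  ... | v′ , w′ , eq with ++-injective v v′ eq
  ... | refl , refl = refl

-- Pair P is definitionally Σ (X k) (OneTo ∘ mult P).
OneTo : ℕ → Set
OneTo c = Σ ℕ λ b → (1 ≤ b) × (b ≤ c)

OneTo-≡ : ∀ {c b b′} {p : 1 ≤ b} {p′ : 1 ≤ b′} {q : b ≤ c} {q′ : b′ ≤ c} → b ≡ b′ → (b , p , q) ≡ (b′ , p′ , q′)
OneTo-≡ {p = p} {p′} {q} {q′} refl = cong₂ (λ p q → _ , p , q) (≤-irrelevant p p′) (≤-irrelevant q q′)

OneTo↔Fin : ∀ c → OneTo c ↔ Fin c
OneTo↔Fin c = mk↔ₛ′ to from (λ i → fromℕ<-toℕ i (toℕ<n i)) from-to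
  where
  to : OneTo c → Fin c
  to (suc b , _ , b<c) = fromℕ< b<c
  from : Fin c → OneTo c
  from i = suc (toℕ i) , s≤s z≤n , toℕ<n i
  from-to : ∀ b → from (to b) ≡ b
  from-to (suc b , s≤s z≤n , b<c) = OneTo-≡ (cong suc (toℕ-fromℕ< b<c))

Composition : ℕ → ℕ → Set
Composition d s = Σ (Vec ℕ d) λ v → sum v ≡ s

Composition-≡ : ∀ {d s} {v w : Vec ℕ d} {e : sum v ≡ s} {e′ : sum w ≡ s} → v ≡ w → (v , e) ≡ (w , e′)
Composition-≡ {e = e} {e′} refl = cong (_ ,_) (≡-irrelevant e e′)

Composition-singleton : ∀ s → Composition 1 s ↔ Fin 1
Composition-singleton s = mk↔ₛ′ (λ _ → zero) (λ _ → s ∷ [] , +-identityʳ s) (λ { zero → refl })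
  (λ { (x ∷ [] , e) → Composition-≡ (cong (_∷ []) (trans (sym e) (+-identityʳ x))) })

Composition-empty : ∀ d → Composition (suc d) 0 ↔ Composition d 0
Composition-empty d = mk↔ₛ′ (λ { (x ∷ v , e) → v , m+n≡0⇒n≡0 x e }) (λ (v , e) → 0 ∷ v , e)
  (λ _ → Composition-≡ refl) (λ { (x ∷ v , e) → Composition-≡ (cong (_∷ v) (sym (m+n≡0⇒m≡0 x e))) })

Composition-split : ∀ d s → Composition (suc d) (suc s) ↔ (Composition d (suc s) ⊎ Composition (suc d) s)
Composition-split d s = mk↔ₛ′ to from to-from from-to
  where
  to : Composition (suc d) (suc s) → Composition d (suc s) ⊎ Composition (suc d) s
  to (zero ∷ v , e) = inj₁ (v , e)
  to (suc x ∷ v , e) = inj₂ (x ∷ v , suc-injective e)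
  from : Composition d (suc s) ⊎ Composition (suc d) s → Composition (suc d) (suc s)
  from (inj₁ (v , e)) = zero ∷ v , e
  from (inj₂ (x ∷ v , e)) = suc x ∷ v , cong suc e
  to-from : ∀ c → to (from c) ≡ c
  to-from (inj₁ _) = refl
  to-from (inj₂ (x ∷ v , e)) = cong inj₂ (Composition-≡ refl)
  from-to : ∀ c → from (to c) ≡ c
  from-to (zero ∷ v , e) = refl
  from-to (suc x ∷ v , e) = Composition-≡ refl

Composition↔Fin : ∀ a s → Composition (suc a) s ↔ Fin ((a + s) C s)
Composition↔Fin zero s = Composition-singleton s ⟫ subst-↔ Fin (sym (nCn≡1 s))
Composition↔Fin (suc a) zero = Composition-empty (suc a) ⟫ Composition↔Fin a zero
Composition↔Fin (suc a) (suc s) =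
  Composition-split (suc a) s ⟫ (Composition↔Fin a (suc s) ⊎-↔ Composition↔Fin (suc a) s) ⟫ Fin-+↔⊎
  ⟫ subst-↔ Fin (sym (pascal a s))

Pointed : ℕ → ℕ → Set
Pointed d m = Σ (ℕ × Vec ℕ d) λ cv → (proj₁ cv + sum (proj₂ cv) ≡ m) × OneTo (proj₁ cv)

Pointed-≡ : ∀ {d m c c′} {v : Vec ℕ d} {b} {e : c + sum v ≡ m} {e′ : c′ + sum v ≡ m}
  {p p′ : 1 ≤ b} {q : b ≤ c} {q′ : b ≤ c′} → c ≡ c′ →
  _≡_ {A = Pointed d m} ((c , v) , e , b , p , q) ((c′ , v) , e′ , b , p′ , q′)
Pointed-≡ {e = e} {e′} {p} {p′} {q} {q′} refl
  rewrite ≡-irrelevant e e′ | ≤-irrelevant p p′ | ≤-irrelevant q q′ = refl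

-- Marking b ∈ [1, c] cuts c into the parts b − 1 and c − b, leaving m − 1 to distribute.
Pointed↔Composition : ∀ d m → Pointed d (suc m) ↔ Composition (2 + d) m
Pointed↔Composition d m = mk↔ₛ′ to from to-from from-to
  where
  to : Pointed d (suc m) → Composition (2 + d) m
  to ((c , v) , e , suc x , _ , x<c) = x ∷ c ∸ suc x ∷ v , suc-injective (begin
    suc (x + (c ∸ suc x + sum v))   ≡⟨ cong suc (+-assoc x _ _) ⟨
    suc (x + (c ∸ suc x)) + sum v   ≡⟨ cong (_+ sum v) (m+[n∸m]≡n x<c) ⟩
    c + sum v                       ≡⟨ e ⟩
    suc m                           ∎)
    where open ≡-Reasoning
  from : Composition (2 + d) m → Pointed d (suc m)
  from (x ∷ y ∷ v , e) =
    (suc (x + y) , v) , cong suc (trans (+-assoc x y (sum v)) e) , suc x , s≤s z≤n , s≤s (m≤m+n x y)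
  to-from : ∀ c → to (from c) ≡ c
  to-from (x ∷ y ∷ v , e) = Composition-≡ (cong (λ y → x ∷ y ∷ v) (m+n∸m≡n x y))
  from-to : ∀ p → from (to p) ≡ p
  from-to ((c , v) , e , suc x , s≤s z≤n , x<c) = Pointed-≡ (m+[n∸m]≡n x<c)

occurrences↔Fin-sizeRest : ∀ {n} (k : Vec ℕ n) (r : MultRest k) →
  Σ (Σ (Fin n) λ i → Fin (lookup k i ∸ 1)) (λ ij → Fin (multRest k r (proj₁ ij) (proj₂ ij))) ↔ Fin (sizeRest k r)
occurrences↔Fin-sizeRest [] tt = mk↔ₛ′ (λ { ((() , _) , _) }) (λ ()) (λ ()) (λ { ((() , _) , _) })
occurrences↔Fin-sizeRest (ki ∷ k) (v , r) =
  Σ-assoc ⟫ Σ-Fin-suc ⟫ (Σ-lookup↔Fin-sum v ⊎-↔ (↔-sym Σ-assoc ⟫ occurrences↔Fin-sizeRest k r)) ⟫ Fin-+↔⊎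

Pair↔Fin-size : ∀ {n} {k : Vec ℕ n} (P : Multiset k) → Pair P ↔ Fin (size P)
Pair↔Fin-size {k = k} (c , r) =
  Σ-↔ ↔-refl (OneTo↔Fin _) ⟫ Σ-Maybe ⟫ (↔-refl ⊎-↔ occurrences↔Fin-sizeRest k r) ⟫ Fin-+↔⊎

module _ {n} {k : Vec ℕ n} (P : Multiset k) where

  LastZero↔OneTo : ∀ l → Σ (Vec (Pair P) (suc l)) LastZero ↔ (Vec (Pair P) l × OneTo (mult P nothing))
  LastZero↔OneTo zero = mk↔ₛ′
    (λ { ((nothing , b) ∷ [] , refl) → [] , b }) (λ { ([] , b) → (nothing , b) ∷ [] , refl })
    (λ { ([] , b) → refl }) (λ { ((nothing , b) ∷ [] , refl) → refl })
  LastZero↔OneTo (suc l) = uncons ⟫ (↔-refl ×-↔ LastZero↔OneTo l) ⟫ ↔-sym Σ-assoc ⟫ (↔-sym Vec-suc↔× ×-↔ ↔-refl)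
    where
    uncons : Σ (Vec (Pair P) (2 + l)) LastZero ↔ (Pair P × Σ (Vec (Pair P) (suc l)) LastZero)
    uncons = mk↔ₛ′ (λ { (x ∷ y ∷ v , e) → x , (y ∷ v , e) }) (λ { (x , (y ∷ v , e)) → x ∷ y ∷ v , e })
      (λ { (x , (y ∷ v , e)) → refl }) (λ { (x ∷ y ∷ v , e) → refl })

  sequences↔Fin : ∀ l → Σ (Vec (Pair P) (suc l)) LastZero ↔ (Fin (size P ^ l) × OneTo (mult P nothing))
  sequences↔Fin l = LastZero↔OneTo l ⟫ (Vec↔Fin^ l (Pair↔Fin-size P) ×-↔ ↔-refl)

nonzeroSymbols : ∀ {n} → Vec ℕ n → ℕ
nonzeroSymbols k = sum (map (_∸ 1) k)

nonzeroSymbols+length≡sum : ∀ {n} (k : Vec ℕ n) → (∀ i → 1 ≤ lookup k i) → nonzeroSymbols k + n ≡ sum k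
nonzeroSymbols+length≡sum [] _ = refl
nonzeroSymbols+length≡sum {suc n} (ki ∷ k) k≥1 = begin
  (ki ∸ 1) + nonzeroSymbols k + suc n     ≡⟨ rearrange (ki ∸ 1) (nonzeroSymbols k) n ⟩
  (ki ∸ 1 + 1) + (nonzeroSymbols k + n)   ≡⟨ cong₂ _+_ (m∸n+n≡m (k≥1 zero)) (nonzeroSymbols+length≡sum k (λ i → k≥1 (suc i))) ⟩
  ki + sum k                              ∎
  where
  open ≡-Reasoning
  rearrange : ∀ a b c → a + b + suc c ≡ (a + 1) + (b + c)
  rearrange = solve-∀

sum∸length≡nonzeroSymbols : ∀ {n} (k : Vec ℕ n) → (∀ i → 1 ≤ lookup k i) → sum k ∸ n ≡ nonzeroSymbols k
sum∸length≡nonzeroSymbols {n} k k≥1 =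
  trans (cong (_∸ n) (sym (nonzeroSymbols+length≡sum k k≥1))) (m+n∸n≡m (nonzeroSymbols k) n)

flatten : ∀ {n} (k : Vec ℕ n) → MultRest k ↔ Vec ℕ (nonzeroSymbols k)
flatten [] = mk↔ₛ′ (λ _ → []) (λ _ → tt) (λ { [] → refl }) (λ _ → refl)
flatten (ki ∷ k) = (↔-refl ×-↔ flatten k) ⟫ ++↔

sum-flatten : ∀ {n} (k : Vec ℕ n) r → sum (Inverse.to (flatten k) r) ≡ sizeRest k r
sum-flatten [] tt = refl
sum-flatten (ki ∷ k) (v , r) = trans (sum-++ v) (cong (sum v +_) (sum-flatten k r))

pointedMultisets↔Pointed : ∀ {n} (k : Vec ℕ n) m →
  Σ (Multiset k) (λ P → (size P ≡ m) × OneTo (mult P nothing)) ↔ Pointed (nonzeroSymbols k) m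
pointedMultisets↔Pointed k m = Σ-↔ (↔-refl ×-↔ flatten k)
  (λ {P} → subst-↔ (λ s → (proj₁ P + s ≡ m) × OneTo (proj₁ P)) (sym (sum-flatten k (proj₂ P))))

lemma2p5 : (n : ℕ) → 1 ≤ n → (k : Vec ℕ n) → (∀ i → 1 ≤ lookup k i) → (m : ℕ) → 1 ≤ m →
    PMm k m ↔ Fin ((m ^ n * ((sum k ∸ n + m) C m)) / suc (sum k ∸ n))
lemma2p5 (suc l) _ k k≥1 (suc m) _ = counting ⟫ subst-↔ Fin (sym formula)
  where
  d = nonzeroSymbols k
  counting : PMm k (suc m) ↔ Fin (suc m ^ l * ((suc d + m) C m))
  counting =
    Σ-↔ ↔-refl (λ {P} → ↔-refl ×-↔ sequences↔Fin P l)
    ⟫ Σ-↔ ↔-refl (λ {P} → ≡×-subst (λ s → Fin (s ^ l) × OneTo (mult P nothing)))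
    ⟫ Σ-×-factor
    ⟫ (↔-refl ×-↔ (pointedMultisets↔Pointed k (suc m) ⟫ Pointed↔Composition d m ⟫ Composition↔Fin (suc d) m))
    ⟫ ↔-sym *↔×
  formula : (suc m ^ suc l * ((sum k ∸ suc l + suc m) C suc m)) / suc (sum k ∸ suc l) ≡ suc m ^ l * ((suc d + m) C m)
  formula = begin
    (suc m ^ suc l * ((sum k ∸ suc l + suc m) C suc m)) / suc (sum k ∸ suc l)
      ≡⟨ cong (λ e → (suc m ^ suc l * ((e + suc m) C suc m)) / suc e) (sum∸length≡nonzeroSymbols k k≥1) ⟩
    (suc m ^ suc l * ((d + suc m) C suc m)) / suc d
      ≡⟨ scaled-absorption (suc m ^ l) d m ⟩
    suc m ^ l * ((suc d + m) C m)
      ∎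
    where open ≡-Reasoning
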